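{- For all integers $m\ge 2$ and $n\ge 1$, $$\overline{T}(n,m)=\overline{T}(n,m-1)+\sum_{k=0}^{\lfloor\frac{n-1}{2}\rfloor}\overline{T}(2k,m-1)\,\overline{T}(n-2k-1,m).$$
   Context: For a positive integer $m$, $A_m$ is the $m\times m$ matrix with $(i,j)$ entry $1$ if $i+j\le m+1$ and $0$ otherwise, $u_m=(1,\dots,1)^T\in\mathbb{R}^m$, $v_{m,1}$ is the first standard unit column vector of $\mathbb{R}^m$, and $\overline{T}(n,m)=u_m^TA_m^nv_{m,1}$ for $n\in\mathbb{N}$. -}

module Defs where

open import Data.Nat using (ℕ; zero; suc; _+_; _*_; _≤ᵇ_; _≡ᵇ_)
open import Data.Bool using (if_then_else_)
open import Data.Fin using (Fin; toℕ)

Mat : ℕ → Set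
Mat m = Fin m → Fin m → ℕ

ColVec : ℕ → Set
ColVec m = Fin m → ℕ

sumFin : (m : ℕ) → (Fin m → ℕ) → ℕ
sumFin zero    f = 0
sumFin (suc m) f = f Fin.zero + sumFin m (λ i → f (Fin.suc i))

sumTo : ℕ → (ℕ → ℕ) → ℕ
sumTo zero    f = f 0
sumTo (suc n) f = sumTo n f + f (suc n)

identity : (m : ℕ) → Mat m
identity m i j = if toℕ i ≡ᵇ toℕ j then 1 else 0

_⊗_ : {m : ℕ} → Mat m → Mat m → Mat m
_⊗_ {m} M N i j = sumFin m (λ k → M i k * N k j)

_^ᴹ_ : {m : ℕ} → Mat m → ℕ → Mat m
_^ᴹ_ {m} M zero    = identity m
_^ᴹ_ {m} M (suc n) = M ⊗ (M ^ᴹ n)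

-- A_m : (i,j) entry (1-based) is 1 iff i + j ≤ m + 1.
-- With 0-based indices i' = i-1, j' = j-1 this is i' + j' + 2 ≤ m + 1.
A : (m : ℕ) → Mat m
A m i j = if (suc (toℕ i) + suc (toℕ j)) ≤ᵇ suc m then 1 else 0

u : (m : ℕ) → ColVec m
u m _ = 1

v₁ : (m : ℕ) → ColVec m
v₁ m i = if toℕ i ≡ᵇ 0 then 1 else 0

Tbar : ℕ → ℕ → ℕ
Tbar n m = sumFin m (λ i → u m i * sumFin m (λ j → (A m ^ᴹ n) i j * v₁ m j))

-- Write A_m = B + J, where B (padA) is A_{m-1} bordered by a zero last row and column and
-- J is the exchange matrix. Expanding A^n = (B + J)^n at the last factor J gives
--   1ᵀ A^n v = 1ᵀ B^n v + Σ_{t<n} 1ᵀ A^{n-1-t} J B^t v.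
-- Because A J + J B is the all-ones matrix, the terms t = 2k and t = 2k+1 add up to
-- (1ᵀ A^{n-2k-2} 1)(1ᵀ B^{2k} v) = T̄(n-2k-1, m) T̄(2k, m-1), using A e₁ = 1; when n is odd the
-- unpaired last term is 1ᵀ J B^{n-1} v = 1ᵀ B^{n-1} v, as J only permutes coordinates.
-- Finally 1ᵀ B^t e₁ = T̄(t, m-1), since B preserves vectors vanishing on the border.
module Submission where

open import Defs
open import Data.Nat using (ℕ; zero; suc; _+_; _*_; _∸_; _≤_; _/_; _≤ᵇ_; _≡ᵇ_; s≤s; s≤s⁻¹; z≤n)
open import Data.Nat.Properties
open import Data.Nat.DivMod using (m/n≡1+[m∸n]/n)
open import Data.Nat.GeneralisedArithmetic using (iterate)
open import Data.Bool using (Bool; true; false; if_then_else_; T)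
open import Data.Unit using (tt)
open import Data.Empty using (⊥-elim)
open import Data.Fin using (Fin; toℕ; inject₁; fromℕ; opposite; punchIn)
open import Data.Fin.Properties using (toℕ-injective; toℕ<n; toℕ-inject₁; toℕ-fromℕ; opposite-prop; punchInᵢ≢i)
open import Data.Fin.Permutation using (reverse)
open import Function using (_∘_)
open import Relation.Nullary using (¬_)
open import Relation.Binary.PropositionalEquality
open import Algebra.Properties.Semiring.Sum +-*-semiring
  using (sum; sum-syntax; sum-cong-≗; sum-replicate-zero; sum-remove; sum-init-last;
         ∑-distrib-+; ∑-comm; ∑-permute; *-distribˡ-sum; *-distribʳ-sum)

open import Algebra.Properties.CommutativeSemigroup *-commutativeSemigroup using (x∙yz≈y∙xz)

open ≡-Reasoning

indicator : Bool → ℕ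
indicator b = if b then 1 else 0

indicator-true : ∀ {b} → T b → indicator b ≡ 1
indicator-true {true} _ = refl

indicator-false : ∀ {b} → ¬ T b → indicator b ≡ 0
indicator-false {false} _  = refl
indicator-false {true}  ¬t = ⊥-elim (¬t tt)

iterate-suc : ∀ {X : Set} (f : X → X) x n → iterate f x (suc n) ≡ f (iterate f x n)
iterate-suc f x zero    = refl
iterate-suc f x (suc n) = iterate-suc f (f x) n

sumTo-suc : ∀ n (f : ℕ → ℕ) → sumTo (suc n) f ≡ f 0 + sumTo n (f ∘ suc)
sumTo-suc zero    f = refl
sumTo-suc (suc n) f = trans (cong (_+ f (2 + n)) (sumTo-suc n f)) (+-assoc (f 0) _ _)

sumTo-cong : ∀ n {f g : ℕ → ℕ} → (∀ k → f k ≡ g k) → sumTo n f ≡ sumTo n g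
sumTo-cong zero    f≗g = f≗g 0
sumTo-cong (suc n) f≗g = cong₂ _+_ (sumTo-cong n f≗g) (f≗g (suc n))

module Pairing {X : Set} (next : X → X) (c : X → ℕ → ℕ) where

  cross : X → ℕ → ℕ
  cross x zero    = 0
  cross x (suc n) = c x n + cross (next x) n

  cross-pairs : (γ : X → ℕ) (g : ℕ → ℕ) →
                (∀ x → c x 0 ≡ γ x * g 0) →
                (∀ x s → c x (suc s) + c (next x) s ≡ γ x * g (suc s)) →
                ∀ n x → cross x (suc n) ≡ sumTo (n / 2) (λ k → γ (iterate next x (2 * k)) * g (n ∸ 2 * k))
  cross-pairs γ g c-zero c-pair = pairs
    where
    pairs : ∀ n x → cross x (suc n) ≡ sumTo (n / 2) (λ k → γ (iterate next x (2 * k)) * g (n ∸ 2 * k))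
    pairs zero          x = trans (+-identityʳ _) (c-zero x)
    pairs (suc zero)    x = trans (cong (c x 1 +_) (+-identityʳ _)) (c-pair x 0)
    pairs (suc (suc n)) x = begin
      c x (2 + n) + (c (next x) (suc n) + cross (next (next x)) (suc n))
        ≡⟨ +-assoc (c x (2 + n)) _ _ ⟨
      c x (2 + n) + c (next x) (suc n) + cross (next (next x)) (suc n)
        ≡⟨ cong₂ _+_ (c-pair x (suc n)) (pairs n (next (next x))) ⟩
      f 0 + sumTo (n / 2) (λ k → γ (iterate next (next (next x)) (2 * k)) * g (n ∸ 2 * k))
        ≡⟨ cong (f 0 +_) (sumTo-cong (n / 2) (λ k → cong (λ j → γ (iterate next x j) * g (2 + n ∸ j)) (*-suc 2 k))) ⟨
      f 0 + sumTo (n / 2) (f ∘ suc)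
        ≡⟨ sumTo-suc (n / 2) f ⟨
      sumTo (suc (n / 2)) f
        ≡⟨ cong (λ q → sumTo q f) (m/n≡1+[m∸n]/n {2 + n} {2} (s≤s (s≤s z≤n))) ⟨
      sumTo ((2 + n) / 2) f ∎
      where
      f : ℕ → ℕ
      f k = γ (iterate next x (2 * k)) * g (2 + n ∸ 2 * k)

sumFin≡sum : ∀ m (f : Fin m → ℕ) → sumFin m f ≡ sum f
sumFin≡sum zero    f = refl
sumFin≡sum (suc m) f = cong (f Fin.zero +_) (sumFin≡sum m (f ∘ Fin.suc))

∑-δ : ∀ {n} (a : Fin n) {g f : Fin n → ℕ} → g a ≡ 1 → (∀ l → l ≢ a → g l ≡ 0) →
      ∑[ l < n ] (g l * f l) ≡ f a
∑-δ {suc n} a {g} {f} ga≡1 g≡0 = begin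
  ∑[ l < suc n ] (g l * f l)                         ≡⟨ sum-remove {i = a} (λ l → g l * f l) ⟩
  g a * f a + ∑[ l < n ] (g (punchIn a l) * f (punchIn a l))
    ≡⟨ cong₂ _+_ (cong (_* f a) ga≡1) (sum-cong-≗ (λ l → cong (_* f (punchIn a l)) (g≡0 _ (punchInᵢ≢i a l)))) ⟩
  1 * f a + ∑[ l < n ] 0                               ≡⟨ cong₂ _+_ (*-identityˡ (f a)) (sum-replicate-zero n) ⟩
  f a + 0                                              ≡⟨ +-identityʳ (f a) ⟩
  f a ∎

infixr 7 _·ᵥ_

_·ᵥ_ : ∀ {m} → Mat m → ColVec m → ColVec m
(_·ᵥ_ {m} M v) i = ∑[ k < m ] (M i k * v k)

module _ {m : ℕ} where

  ·ᵥ-cong : ∀ (M : Mat m) {v w} → (∀ i → v i ≡ w i) → ∀ i → (M ·ᵥ v) i ≡ (M ·ᵥ w) i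
  ·ᵥ-cong M v≗w i = sum-cong-≗ (λ k → cong (M i k *_) (v≗w k))

  ·ᵥ-distrib-+ : ∀ (M : Mat m) v w i → (M ·ᵥ (λ k → v k + w k)) i ≡ (M ·ᵥ v) i + (M ·ᵥ w) i
  ·ᵥ-distrib-+ M v w i = trans (sum-cong-≗ (λ k → *-distribˡ-+ (M i k) (v k) (w k))) (∑-distrib-+ (λ k → M i k * v k) (λ k → M i k * w k))

  ·ᵥ-scale : ∀ (M : Mat m) c v i → (M ·ᵥ (λ k → c * v k)) i ≡ c * (M ·ᵥ v) i
  ·ᵥ-scale M c v i = begin
    ∑[ k < m ] (M i k * (c * v k)) ≡⟨ sum-cong-≗ (λ k → x∙yz≈y∙xz (M i k) c (v k)) ⟩
    ∑[ k < m ] (c * (M i k * v k)) ≡⟨ *-distribˡ-sum c (λ k → M i k * v k) ⟨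
    c * (M ·ᵥ v) i ∎

  ·ᵥ-split : ∀ {M N K : Mat m} → (∀ i k → M i k ≡ N i k + K i k) →
             ∀ v i → (M ·ᵥ v) i ≡ (N ·ᵥ v) i + (K ·ᵥ v) i
  ·ᵥ-split {M} {N} {K} M≡N+K v i = begin
    ∑[ k < m ] (M i k * v k)                 ≡⟨ sum-cong-≗ (λ k → trans (cong (_* v k) (M≡N+K i k)) (*-distribʳ-+ (v k) (N i k) (K i k))) ⟩
    ∑[ k < m ] (N i k * v k + K i k * v k)  ≡⟨ ∑-distrib-+ (λ k → N i k * v k) (λ k → K i k * v k) ⟩
    (N ·ᵥ v) i + (K ·ᵥ v) i ∎

  ⊗-·ᵥ : ∀ (M N : Mat m) v i → ((M ⊗ N) ·ᵥ v) i ≡ (M ·ᵥ (N ·ᵥ v)) i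
  ⊗-·ᵥ M N v i = begin
    ∑[ k < m ] (sumFin m (λ l → M i l * N l k) * v k)  ≡⟨ sum-cong-≗ (λ k → cong (_* v k) (sumFin≡sum m _)) ⟩
    ∑[ k < m ] (∑[ l < m ] (M i l * N l k) * v k)      ≡⟨ sum-cong-≗ (λ k → *-distribʳ-sum (v k) (λ l → M i l * N l k)) ⟩
    ∑[ k < m ] ∑[ l < m ] (M i l * N l k * v k)        ≡⟨ ∑-comm (λ k l → M i l * N l k * v k) ⟩
    ∑[ l < m ] ∑[ k < m ] (M i l * N l k * v k)        ≡⟨ sum-cong-≗ (λ l → sum-cong-≗ (λ k → *-assoc (M i l) (N l k) (v k))) ⟩
    ∑[ l < m ] ∑[ k < m ] (M i l * (N l k * v k))      ≡⟨ sum-cong-≗ (λ l → *-distribˡ-sum (M i l) (λ k → N l k * v k)) ⟨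
    (M ·ᵥ (N ·ᵥ v)) i ∎

  identity-·ᵥ : ∀ v i → (identity m ·ᵥ v) i ≡ v i
  identity-·ᵥ v i = ∑-δ i (indicator-true (≡⇒≡ᵇ (toℕ i) (toℕ i) refl))
    (λ l l≢i → indicator-false (λ eq → l≢i (toℕ-injective (sym (≡ᵇ⇒≡ (toℕ i) (toℕ l) eq)))))

module _ {m : ℕ} (M : Mat m) where

  iterate-·ᵥ-cong : ∀ {v w} → (∀ i → v i ≡ w i) → ∀ n i → iterate (M ·ᵥ_) v n i ≡ iterate (M ·ᵥ_) w n i
  iterate-·ᵥ-cong v≗w zero    = v≗w
  iterate-·ᵥ-cong v≗w (suc n) = iterate-·ᵥ-cong (·ᵥ-cong M v≗w) n

  iterate-·ᵥ-+ : ∀ v w n i →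
                 iterate (M ·ᵥ_) (λ k → v k + w k) n i ≡ iterate (M ·ᵥ_) v n i + iterate (M ·ᵥ_) w n i
  iterate-·ᵥ-+ v w zero    i = refl
  iterate-·ᵥ-+ v w (suc n) i =
    trans (iterate-·ᵥ-cong (·ᵥ-distrib-+ M v w) n i) (iterate-·ᵥ-+ (M ·ᵥ v) (M ·ᵥ w) n i)

  iterate-·ᵥ-scale : ∀ c v n i → iterate (M ·ᵥ_) (λ k → c * v k) n i ≡ c * iterate (M ·ᵥ_) v n i
  iterate-·ᵥ-scale c v zero    i = refl
  iterate-·ᵥ-scale c v (suc n) i =
    trans (iterate-·ᵥ-cong (·ᵥ-scale M c v) n i) (iterate-·ᵥ-scale c (M ·ᵥ v) n i)

  ^ᴹ-·ᵥ : ∀ n v i → ((M ^ᴹ n) ·ᵥ v) i ≡ iterate (M ·ᵥ_) v n i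
  ^ᴹ-·ᵥ zero    v i = identity-·ᵥ v i
  ^ᴹ-·ᵥ (suc n) v i = begin
    ((M ⊗ (M ^ᴹ n)) ·ᵥ v) i       ≡⟨ ⊗-·ᵥ M (M ^ᴹ n) v i ⟩
    (M ·ᵥ ((M ^ᴹ n) ·ᵥ v)) i      ≡⟨ ·ᵥ-cong M (^ᴹ-·ᵥ n v) i ⟩
    (M ·ᵥ iterate (M ·ᵥ_) v n) i  ≡⟨ cong-app (iterate-suc (M ·ᵥ_) v n) i ⟨
    iterate (M ·ᵥ_) v (suc n) i   ∎

Tbar≡sum-iterate : ∀ n m → Tbar n m ≡ sum (iterate (A m ·ᵥ_) (v₁ m) n)
Tbar≡sum-iterate n m = begin
  Tbar n m
    ≡⟨ sumFin≡sum m _ ⟩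
  ∑[ i < m ] (1 * sumFin m (λ j → (A m ^ᴹ n) i j * v₁ m j))
    ≡⟨ sum-cong-≗ {m} (λ i → trans (*-identityˡ _) (sumFin≡sum m _)) ⟩
  sum ((A m ^ᴹ n) ·ᵥ v₁ m)
    ≡⟨ sum-cong-≗ (^ᴹ-·ᵥ (A m) n (v₁ m)) ⟩
  sum (iterate (A m ·ᵥ_) (v₁ m) n) ∎

module Splitting {m : ℕ} {M N K : Mat m} (M≡N+K : ∀ i k → M i k ≡ N i k + K i k) where

  crossTerm : ColVec m → ℕ → ℕ
  crossTerm x s = sum (iterate (M ·ᵥ_) (K ·ᵥ x) s)

  open Pairing (N ·ᵥ_) crossTerm public

  sum-iterate-split : ∀ n v → sum (iterate (M ·ᵥ_) v n) ≡ sum (iterate (N ·ᵥ_) v n) + cross v n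
  sum-iterate-split zero    v = sym (+-identityʳ (sum v))
  sum-iterate-split (suc n) v = begin
    sum (iterate (M ·ᵥ_) (M ·ᵥ v) n)
      ≡⟨ sum-cong-≗ {m} (iterate-·ᵥ-cong M (·ᵥ-split {N = N} {K} M≡N+K v) n) ⟩
    sum (iterate (M ·ᵥ_) (λ k → (N ·ᵥ v) k + (K ·ᵥ v) k) n)
      ≡⟨ sum-cong-≗ (iterate-·ᵥ-+ M (N ·ᵥ v) (K ·ᵥ v) n) ⟩
    ∑[ i < m ] (iterate (M ·ᵥ_) (N ·ᵥ v) n i + iterate (M ·ᵥ_) (K ·ᵥ v) n i)
      ≡⟨ ∑-distrib-+ (iterate (M ·ᵥ_) (N ·ᵥ v) n) (iterate (M ·ᵥ_) (K ·ᵥ v) n) ⟩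
    sum (iterate (M ·ᵥ_) (N ·ᵥ v) n) + crossTerm v n
      ≡⟨ cong (_+ crossTerm v n) (sum-iterate-split n (N ·ᵥ v)) ⟩
    sum (iterate (N ·ᵥ_) (N ·ᵥ v) n) + cross (N ·ᵥ v) n + crossTerm v n
      ≡⟨ +-assoc (sum (iterate (N ·ᵥ_) (N ·ᵥ v) n)) _ _ ⟩
    sum (iterate (N ·ᵥ_) (N ·ᵥ v) n) + (cross (N ·ᵥ v) n + crossTerm v n)
      ≡⟨ cong (sum (iterate (N ·ᵥ_) (N ·ᵥ v) n) +_) (+-comm (cross (N ·ᵥ v) n) _) ⟩
    sum (iterate (N ·ᵥ_) (N ·ᵥ v) n) + cross v (suc n) ∎

  crossTerm-pairs : (∀ i j → (M ⊗ K) i j + (K ⊗ N) i j ≡ 1) →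
                    ∀ x s → crossTerm x (suc s) + crossTerm (N ·ᵥ x) s ≡ sum x * sum (iterate (M ·ᵥ_) (u m) s)
  crossTerm-pairs MK+KN≡1 x s = begin
    crossTerm x (suc s) + crossTerm (N ·ᵥ x) s
      ≡⟨ ∑-distrib-+ (iterate (M ·ᵥ_) (M ·ᵥ (K ·ᵥ x)) s) (iterate (M ·ᵥ_) (K ·ᵥ (N ·ᵥ x)) s) ⟨
    ∑[ i < m ] (iterate (M ·ᵥ_) (M ·ᵥ (K ·ᵥ x)) s i + iterate (M ·ᵥ_) (K ·ᵥ (N ·ᵥ x)) s i)
      ≡⟨ sum-cong-≗ (iterate-·ᵥ-+ M (M ·ᵥ (K ·ᵥ x)) (K ·ᵥ (N ·ᵥ x)) s) ⟨
    sum (iterate (M ·ᵥ_) (λ i → (M ·ᵥ (K ·ᵥ x)) i + (K ·ᵥ (N ·ᵥ x)) i) s)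
      ≡⟨ sum-cong-≗ (iterate-·ᵥ-cong M constant s) ⟩
    sum (iterate (M ·ᵥ_) (λ i → sum x * u m i) s)
      ≡⟨ sum-cong-≗ (iterate-·ᵥ-scale M (sum x) (u m) s) ⟩
    ∑[ i < m ] (sum x * iterate (M ·ᵥ_) (u m) s i)
      ≡⟨ *-distribˡ-sum (sum x) (iterate (M ·ᵥ_) (u m) s) ⟨
    sum x * sum (iterate (M ·ᵥ_) (u m) s) ∎
    where
    constant : ∀ i → (M ·ᵥ (K ·ᵥ x)) i + (K ·ᵥ (N ·ᵥ x)) i ≡ sum x * u m i
    constant i = begin
      (M ·ᵥ (K ·ᵥ x)) i + (K ·ᵥ (N ·ᵥ x)) i  ≡⟨ cong₂ _+_ (⊗-·ᵥ M K x i) (⊗-·ᵥ K N x i) ⟨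
      ((M ⊗ K) ·ᵥ x) i + ((K ⊗ N) ·ᵥ x) i    ≡⟨ ·ᵥ-split {N = M ⊗ K} {K ⊗ N} (λ i j → sym (MK+KN≡1 i j)) x i ⟨
      ∑[ j < m ] (1 * x j)                    ≡⟨ sum-cong-≗ {m} (λ j → *-identityˡ (x j)) ⟩
      sum x                                   ≡⟨ *-identityʳ (sum x) ⟨
      sum x * 1 ∎

module _ {n : ℕ} where

  record IsZeroPadding (v : ColVec (suc n)) (w : ColVec n) : Set where
    constructor zeroPadding
    field
      init-entries : ∀ i → v (inject₁ i) ≡ w i
      last-entry   : v (fromℕ n) ≡ 0

  sum-zeroPadding : ∀ {v w} → IsZeroPadding v w → sum v ≡ sum w
  sum-zeroPadding {v} {w} (zeroPadding v≗w v-last≡0) = begin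
    sum v                                  ≡⟨ sum-init-last v ⟩
    ∑[ i < n ] v (inject₁ i) + v (fromℕ n)  ≡⟨ cong₂ _+_ (sum-cong-≗ v≗w) v-last≡0 ⟩
    sum w + 0                              ≡⟨ +-identityʳ (sum w) ⟩
    sum w ∎

  module _ {M : Mat (suc n)} {N : Mat n}
           (M-init : ∀ i k → M (inject₁ i) (inject₁ k) ≡ N i k)
           (M-last : ∀ k → M (fromℕ n) k ≡ 0) where

    ·ᵥ-zeroPadding : ∀ {v w} → IsZeroPadding v w → IsZeroPadding (M ·ᵥ v) (N ·ᵥ w)
    ·ᵥ-zeroPadding {v} {w} (zeroPadding v≗w v-last≡0) = zeroPadding init-entries last-entry
      where
      init-entries : ∀ i → (M ·ᵥ v) (inject₁ i) ≡ (N ·ᵥ w) i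
      init-entries i = begin
        ∑[ k < suc n ] (M (inject₁ i) k * v k)
          ≡⟨ sum-init-last (λ k → M (inject₁ i) k * v k) ⟩
        ∑[ k < n ] (M (inject₁ i) (inject₁ k) * v (inject₁ k)) + M (inject₁ i) (fromℕ n) * v (fromℕ n)
          ≡⟨ cong₂ _+_ (sum-cong-≗ (λ k → cong₂ _*_ (M-init i k) (v≗w k))) (cong (M (inject₁ i) (fromℕ n) *_) v-last≡0) ⟩
        (N ·ᵥ w) i + M (inject₁ i) (fromℕ n) * 0
          ≡⟨ cong ((N ·ᵥ w) i +_) (*-zeroʳ (M (inject₁ i) (fromℕ n))) ⟩
        (N ·ᵥ w) i + 0
          ≡⟨ +-identityʳ _ ⟩
        (N ·ᵥ w) i ∎

      last-entry : (M ·ᵥ v) (fromℕ n) ≡ 0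
      last-entry = trans (sum-cong-≗ {suc n} (λ k → cong (_* v k) (M-last k))) (sum-replicate-zero (suc n))

    iterate-zeroPadding : ∀ {v w} → IsZeroPadding v w → ∀ t → IsZeroPadding (iterate (M ·ᵥ_) v t) (iterate (N ·ᵥ_) w t)
    iterate-zeroPadding {v} {w} padding zero    = padding
    iterate-zeroPadding {v} {w} padding (suc t) = iterate-zeroPadding (·ᵥ-zeroPadding {v} {w} padding) t

indicator-≤ᵇ-suc : ∀ x n → indicator (x ≤ᵇ suc n) ≡ indicator (x ≤ᵇ n) + indicator (x ≡ᵇ suc n)
indicator-≤ᵇ-suc zero          n       = refl
indicator-≤ᵇ-suc (suc zero)    zero    = refl
indicator-≤ᵇ-suc (suc (suc x)) zero    = refl
indicator-≤ᵇ-suc (suc zero)    (suc n) = refl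
indicator-≤ᵇ-suc (suc (suc x)) (suc n) = indicator-≤ᵇ-suc (suc x) n

indicator-≤ᵇ-complement : ∀ a b → indicator (a ≤ᵇ b) + indicator (suc b ≤ᵇ a) ≡ 1
indicator-≤ᵇ-complement zero          b       = refl
indicator-≤ᵇ-complement (suc a)       zero    = refl
indicator-≤ᵇ-complement (suc zero)    (suc b) = indicator-≤ᵇ-complement zero b
indicator-≤ᵇ-complement (suc (suc a)) (suc b) = indicator-≤ᵇ-complement (suc a) b

suc-≤ᵇ-suc : ∀ a b → (suc a ≤ᵇ suc b) ≡ (a ≤ᵇ b)
suc-≤ᵇ-suc zero    b = refl
suc-≤ᵇ-suc (suc a) b = refl

+-≤ᵇ-cancelˡ : ∀ c a b → (c + a ≤ᵇ c + b) ≡ (a ≤ᵇ b)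
+-≤ᵇ-cancelˡ zero    a b = refl
+-≤ᵇ-cancelˡ (suc c) a b = trans (suc-≤ᵇ-suc (c + a) (c + b)) (+-≤ᵇ-cancelˡ c a b)

padA : (m : ℕ) → Mat m
padA m i k = indicator (suc (toℕ i) + suc (toℕ k) ≤ᵇ m)

exchange : (m : ℕ) → Mat m
exchange m i k = indicator (suc (toℕ i) + suc (toℕ k) ≡ᵇ suc m)

A≡padA+exchange : ∀ m i k → A m i k ≡ padA m i k + exchange m i k
A≡padA+exchange m i k = indicator-≤ᵇ-suc (suc (toℕ i) + suc (toℕ k)) m

+-suc-comm : ∀ a b → a + suc b ≡ b + suc a
+-suc-comm a b = trans (+-suc a b) (trans (cong suc (+-comm a b)) (sym (+-suc b a)))

toℕ-opposite-+-suc : ∀ {m} (i : Fin m) → toℕ (opposite i) + suc (toℕ i) ≡ m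
toℕ-opposite-+-suc i = trans (cong (_+ suc (toℕ i)) (opposite-prop i)) (m∸n+n≡m (toℕ<n i))

module _ {m : ℕ} where

  exchange-sym : ∀ i k → exchange m i k ≡ exchange m k i
  exchange-sym i k = cong (λ x → indicator (x ≡ᵇ suc m)) (+-comm (suc (toℕ i)) (suc (toℕ k)))

  exchange-·ᵥ : ∀ x i → (exchange m ·ᵥ x) i ≡ x (opposite i)
  exchange-·ᵥ x i = ∑-δ (opposite i) (indicator-true (≡⇒≡ᵇ _ _ hit)) miss
    where
    p = toℕ i
    opp-spec : toℕ (opposite i) + suc p ≡ m
    opp-spec = toℕ-opposite-+-suc i

    hit : suc p + suc (toℕ (opposite i)) ≡ suc m
    hit = cong suc (trans (+-suc-comm p (toℕ (opposite i))) opp-spec)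

    miss : ∀ l → l ≢ opposite i → exchange m i l ≡ 0
    miss l l≢opp = indicator-false λ t → l≢opp (toℕ-injective (+-cancelʳ-≡ (suc p) _ _
      (trans (+-suc-comm (toℕ l) p) (trans (suc-injective (≡ᵇ⇒≡ _ _ t)) (sym opp-spec)))))

  sum-exchange-·ᵥ : ∀ x → sum (exchange m ·ᵥ x) ≡ sum x
  sum-exchange-·ᵥ x = trans (sum-cong-≗ (exchange-·ᵥ x)) (sym (∑-permute x reverse))

  A⊗exchange+exchange⊗padA≡1 : ∀ i j → (A m ⊗ exchange m) i j + (exchange m ⊗ padA m) i j ≡ 1
  A⊗exchange+exchange⊗padA≡1 i j = begin
    (A m ⊗ exchange m) i j + (exchange m ⊗ padA m) i j
      ≡⟨ cong₂ _+_ (trans (sumFin≡sum m _) (sum-cong-≗ λ l → trans (*-comm (A m i l) (exchange m l j)) (cong (_* A m i l) (exchange-sym l j))))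
                   (sumFin≡sum m _) ⟩
    (exchange m ·ᵥ A m i) j + (exchange m ·ᵥ (λ l → padA m l j)) i
      ≡⟨ cong₂ _+_ (exchange-·ᵥ (A m i) j) (exchange-·ᵥ (λ l → padA m l j) i) ⟩
    A m i (opposite j) + padA m (opposite i) j
      ≡⟨ cong₂ (λ a b → indicator a + indicator b) first second ⟩
    indicator (suc p ≤ᵇ suc q) + indicator (suc (suc q) ≤ᵇ suc p)
      ≡⟨ indicator-≤ᵇ-complement (suc p) (suc q) ⟩
    1 ∎
    where
    p = toℕ i
    q = toℕ j
    first : (suc p + suc (toℕ (opposite j)) ≤ᵇ suc m) ≡ (suc p ≤ᵇ suc q)
    first = trans (cong₂ _≤ᵇ_ (+-comm (suc p) _) (cong suc (sym (toℕ-opposite-+-suc j))))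
                  (+-≤ᵇ-cancelˡ (suc (toℕ (opposite j))) (suc p) (suc q))
    second : (suc (toℕ (opposite i)) + suc q ≤ᵇ m) ≡ (suc (suc q) ≤ᵇ suc p)
    second = trans (cong₂ _≤ᵇ_ (sym (+-suc (toℕ (opposite i)) (suc q))) (sym (toℕ-opposite-+-suc i)))
                   (+-≤ᵇ-cancelˡ (toℕ (opposite i)) (suc (suc q)) (suc p))

·ᵥ-v₁ : ∀ {m} (M : Mat (suc m)) i → (M ·ᵥ v₁ (suc m)) i ≡ M i Fin.zero
·ᵥ-v₁ {m} M i = trans (sum-cong-≗ {suc m} (λ k → *-comm (M i k) (v₁ (suc m) k))) (∑-δ Fin.zero {v₁ (suc m)} {M i} refl v₁-off)
  where
  v₁-off : ∀ l → l ≢ Fin.zero → v₁ (suc m) l ≡ 0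
  v₁-off Fin.zero    l≢0 = ⊥-elim (l≢0 refl)
  v₁-off (Fin.suc l) _   = refl

sum-v₁ : ∀ m → sum (v₁ (suc m)) ≡ 1
sum-v₁ m = cong suc (sum-replicate-zero m)

A·v₁≡u : ∀ m i → (A (suc m) ·ᵥ v₁ (suc m)) i ≡ u (suc m) i
A·v₁≡u m i = trans (·ᵥ-v₁ (A (suc m)) i) (indicator-true (≤⇒≤ᵇ (s≤s (subst (_≤ suc m) (+-comm 1 (toℕ i)) (toℕ<n i)))))

Tbar≡sum-iterate-padA : ∀ m t → Tbar t (suc m) ≡ sum (iterate (padA (suc (suc m)) ·ᵥ_) (v₁ (suc (suc m))) t)
Tbar≡sum-iterate-padA m t =
  trans (Tbar≡sum-iterate t (suc m)) (sym (sum-zeroPadding (iterate-zeroPadding {M = padA (suc (suc m))} padA-init padA-last v₁-zeroPadding t)))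
  where
  padA-init : ∀ i k → padA (suc (suc m)) (inject₁ i) (inject₁ k) ≡ A (suc m) i k
  padA-init i k = cong₂ (λ a b → indicator (suc a + suc b ≤ᵇ suc (suc m))) (toℕ-inject₁ i) (toℕ-inject₁ k)

  padA-last : ∀ k → padA (suc (suc m)) (fromℕ (suc m)) k ≡ 0
  padA-last k = trans (cong (λ a → indicator (suc a + suc (toℕ k) ≤ᵇ suc (suc m))) (toℕ-fromℕ (suc m)))
                      (indicator-false λ t → m+1+n≰m (suc m) (s≤s⁻¹ (≤ᵇ⇒≤ _ _ t)))

  v₁-zeroPadding : IsZeroPadding (v₁ (suc (suc m))) (v₁ (suc m))
  v₁-zeroPadding = zeroPadding (λ i → cong (λ a → indicator (a ≡ᵇ 0)) (toℕ-inject₁ i)) refl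

module ExchangeSplitting (m : ℕ) where

  open Splitting {N = padA (suc m)} {exchange (suc m)} (A≡padA+exchange (suc m)) public

  crossTerm-zero : ∀ x → crossTerm x 0 ≡ sum x * Tbar 0 (suc m)
  crossTerm-zero x = begin
    sum (exchange (suc m) ·ᵥ x)           ≡⟨ sum-exchange-·ᵥ x ⟩
    sum x                                ≡⟨ *-identityʳ (sum x) ⟨
    sum x * 1                            ≡⟨ cong (sum x *_) (trans (sym (sum-v₁ m)) (sym (Tbar≡sum-iterate 0 (suc m)))) ⟩
    sum x * Tbar 0 (suc m) ∎

  crossTerm-pair : ∀ x s → crossTerm x (suc s) + crossTerm (padA (suc m) ·ᵥ x) s ≡ sum x * Tbar (suc s) (suc m)
  crossTerm-pair x s = begin
    crossTerm x (suc s) + crossTerm (padA (suc m) ·ᵥ x) s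
      ≡⟨ crossTerm-pairs A⊗exchange+exchange⊗padA≡1 x s ⟩
    sum x * sum (iterate (A (suc m) ·ᵥ_) (u (suc m)) s)
      ≡⟨ cong (sum x *_) (sum-cong-≗ (iterate-·ᵥ-cong (A (suc m)) (λ i → sym (A·v₁≡u m i)) s)) ⟩
    sum x * sum (iterate (A (suc m) ·ᵥ_) (v₁ (suc m)) (suc s))
      ≡⟨ cong (sum x *_) (Tbar≡sum-iterate (suc s) (suc m)) ⟨
    sum x * Tbar (suc s) (suc m) ∎

corollary3p6 : (m n : ℕ) → 2 ≤ m → 1 ≤ n →
    Tbar n m ≡ Tbar n (m ∸ 1) + sumTo ((n ∸ 1) / 2) (λ k → Tbar (2 * k) (m ∸ 1) * Tbar (n ∸ 2 * k ∸ 1) m)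
corollary3p6 (suc (suc m)) (suc n) (s≤s (s≤s _)) (s≤s _) = begin
  Tbar (suc n) (2 + m)
    ≡⟨ Tbar≡sum-iterate (suc n) (2 + m) ⟩
  sum (iterate (A (2 + m) ·ᵥ_) (v₁ (2 + m)) (suc n))
    ≡⟨ sum-iterate-split (suc n) (v₁ (2 + m)) ⟩
  sum (iterate (padA (2 + m) ·ᵥ_) (v₁ (2 + m)) (suc n)) + cross (v₁ (2 + m)) (suc n)
    ≡⟨ cong₂ _+_ (sym (Tbar≡sum-iterate-padA m (suc n)))
                 (cross-pairs sum (λ t → Tbar t (2 + m)) crossTerm-zero crossTerm-pair n (v₁ (2 + m))) ⟩
  Tbar (suc n) (suc m) + sumTo (n / 2) (λ k → sum (iterate (padA (2 + m) ·ᵥ_) (v₁ (2 + m)) (2 * k)) * Tbar (n ∸ 2 * k) (2 + m))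
    ≡⟨ cong (Tbar (suc n) (suc m) +_) (sumTo-cong (n / 2) summand) ⟩
  Tbar (suc n) (suc m) + sumTo (n / 2) (λ k → Tbar (2 * k) (suc m) * Tbar (suc n ∸ 2 * k ∸ 1) (2 + m)) ∎
  where
  open ExchangeSplitting (suc m)

  summand : ∀ k → sum (iterate (padA (2 + m) ·ᵥ_) (v₁ (2 + m)) (2 * k)) * Tbar (n ∸ 2 * k) (2 + m)
                ≡ Tbar (2 * k) (suc m) * Tbar (suc n ∸ 2 * k ∸ 1) (2 + m)
  summand k = cong₂ _*_ (sym (Tbar≡sum-iterate-padA m (2 * k)))
    (cong (λ t → Tbar t (2 + m)) (sym (trans (∸-+-assoc (suc n) (2 * k) 1) (cong (suc n ∸_) (+-comm (2 * k) 1)))))
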